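{- In a GCR game family in which the players move alternately, let $\widehat{T}(s)$ denote the value of the game started at $s\in\overline{S}$ and let $T^0,T^1,\dots$ be the labels produced by the vertex labeling algorithm. Then for every $n\in\mathbb{N}_0$ and every $s\in\overline{S}$ with $\widehat{T}(s)=n$: $T^m(s)=\infty$ for all $m<n$, and $T^m(s)=\widehat{T}(s)$ for all $m\ge n$.
   Context: A GCR game family consists of: finite location sets $V^1,V^2$; nonterminal states $\overline{S}=V^1\times V^2\times\{1,2\}$, where in state $(x^1,x^2,n)$ player $P^n$ has the move ($P^1$ Pursuer, $P^2$ Evader); $S^n=\{(x^1,x^2,n)\}$; a set of capture states $S_c\subseteq\overline{S}$, $S_{nc}=\overline{S}\setminus S_c$; a terminal state $\tau$; for each $s\in S_{nc}$ a nonempty set $N(s)\subseteq\overline{S}$ of possible next states, while $N(s)=\{\tau\}$ for $s\in S_c$ and $N(\tau)=\{\tau\}$. Alternating moves means: for every $s\in S^n\setminus S_c$, $N(s)\subseteq S^{ -n}$, where $-n$ denotes the other player. A (pure) strategy for $P^n$ is a map $\sigma^n$ from finite sequences of states $s_0\dots s_t$ to states with $\sigma^n(s_0\dots s_t)\in N(s_t)$ whenever $s_t\in S^n\setminus S_c$. Given strategies and $s_0$, the play is $s_{t+1}=\sigma^n(s_0\dots s_t)$ if $s_t\in S^n\setminus S_c$ and $s_{t+1}=\tau$ if $s_t\in S_c\cup\{\tau\}$. The capture time $T(\sigma^1,\sigma^2\mid s_0)$ is the number of $t$ with $s_t\in S_{nc}$ (the first time a capture state is reached, or $\infty$). For every $s\in\overline{S}$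 the game from $s$ has a value, i.e. $\sup_{\sigma^2}\inf_{\sigma^1}T(\sigma^1,\sigma^2\mid s)=\inf_{\sigma^1}\sup_{\sigma^2}T(\sigma^1,\sigma^2\mid s)$; this common quantity is denoted $\widehat{T}(s)$. Vertex labeling algorithm: $T^0(s)=0$ if $s\in S_c$, $T^0(s)=\infty$ otherwise; for $i\ge1$ and $s\in\overline{S}$: if $T^{i-1}(s)<\infty$ then $T^i(s)=T^{i-1}(s)$; else if $s\in S^1$ then $T^i(s)=1+\min_{s'\in N(s)}T^{i-1}(s')$, and if $s\in S^2$ then $T^i(s)=1+\max_{s'\in N(s)}T^{i-1}(s')$ (with $1+\infty=\infty$). -}

module Defs where

open import Data.Nat using (ℕ; zero; suc; _<_; _⊓_; _⊔_)
import Data.Nat as ℕ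
open import Data.Fin using (Fin)
open import Data.Bool using (Bool; true; false; if_then_else_)
open import Data.List using (List; []; _∷_; _∷ʳ_; filter; foldr; map; allFin; cartesianProduct)
open import Data.Product using (Σ; ∃; ∃-syntax; _×_; _,_)
open import Data.Empty using (⊥)
open import Data.Unit using (⊤)
open import Relation.Binary.PropositionalEquality using (_≡_)
open import Relation.Nullary.Decidable using (⌊_⌋)
import Data.Bool as B

data ℕ∞ : Set where
  fin : ℕ → ℕ∞
  ∞   : ℕ∞

data _≤∞_ : ℕ∞ → ℕ∞ → Set where
  fin≤fin : ∀ {m n} → m ℕ.≤ n → fin m ≤∞ fin n
  ≤∞-top  : ∀ {x} → x ≤∞ ∞

suc∞ : ℕ∞ → ℕ∞
suc∞ (fin n) = fin (suc n)
suc∞ ∞       = ∞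

_⊓∞_ : ℕ∞ → ℕ∞ → ℕ∞
fin m ⊓∞ fin n = fin (m ⊓ n)
fin m ⊓∞ ∞     = fin m
∞     ⊓∞ y     = y

_⊔∞_ : ℕ∞ → ℕ∞ → ℕ∞
fin m ⊔∞ fin n = fin (m ⊔ n)
fin m ⊔∞ ∞     = ∞
∞     ⊔∞ y     = ∞

-- min / max of a list (the lists used below are nonempty whenever the
-- value matters; the empty-list defaults are never used by the algorithm)
minimum∞ : List ℕ∞ → ℕ∞
minimum∞ = foldr _⊓∞_ ∞

maximum∞ : List ℕ∞ → ℕ∞
maximum∞ = foldr _⊔∞_ (fin 0)

IsSup : (ℕ∞ → Set) → ℕ∞ → Set
IsSup P u = (∀ w → P w → w ≤∞ u) × (∀ u′ → (∀ w → P w → w ≤∞ u′) → u ≤∞ u′)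

IsInf : (ℕ∞ → Set) → ℕ∞ → Set
IsInf P l = (∀ w → P w → l ≤∞ w) × (∀ l′ → (∀ w → P w → l′ ≤∞ w) → l′ ≤∞ l)

data Player : Set where
  P1 P2 : Player   -- P1 = Pursuer, P2 = Evader

other : Player → Player
other P1 = P2
other P2 = P1

-- nonterminal states  S̄ = V¹ × V² × {1,2}, with V¹ = Fin k₁, V² = Fin k₂
NState : ℕ → ℕ → Set
NState k₁ k₂ = Fin k₁ × Fin k₂ × Player

player : ∀ {k₁ k₂} → NState k₁ k₂ → Player
player (_ , _ , p) = p

allNStates : ∀ k₁ k₂ → List (NState k₁ k₂)
allNStates k₁ k₂ =
  cartesianProduct (allFin k₁) (cartesianProduct (allFin k₂) (P1 ∷ P2 ∷ []))

data State (k₁ k₂ : ℕ) : Set where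
  st : NState k₁ k₂ → State k₁ k₂
  τ  : State k₁ k₂

record GCR (k₁ k₂ : ℕ) : Set where
  field
    capture : NState k₁ k₂ → Bool                  -- characteristic function of S_c
    next    : NState k₁ k₂ → NState k₁ k₂ → Bool   -- s′ ∈ N(s), for s ∈ S_nc
    next-nonempty : ∀ s → capture s ≡ false → ∃[ s′ ] next s s′ ≡ true
    alternating   : ∀ s s′ → capture s ≡ false → next s s′ ≡ true →
                    player s′ ≡ other (player s)

module _ {k₁ k₂ : ℕ} (G : GCR k₁ k₂) where
  open GCR G

  InSc : State k₁ k₂ → Set
  InSc (st s) = capture s ≡ true
  InSc τ      = ⊥

  InSnc : State k₁ k₂ → Set
  InSnc (st s) = capture s ≡ false
  InSnc τ      = ⊥

  Move : NState k₁ k₂ → State k₁ k₂ → Set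
  Move s (st s′) = next s s′ ≡ true
  Move s τ       = ⊥

  -- A pure strategy for player p: a map from finite sequences of states
  -- s₀ … s_t (given as the prefix s₀ … s_{t-1}, in order, and the current
  -- state s_t) to states, which is legal whenever s_t ∈ Sᵖ ∖ S_c.
  record Strategy (p : Player) : Set where
    field
      σ     : List (State k₁ k₂) → State k₁ k₂ → State k₁ k₂
      legal : ∀ h s → player s ≡ p → capture s ≡ false → Move s (σ h (st s))

  open Strategy

  step : Strategy P1 → Strategy P2 → List (State k₁ k₂) → State k₁ k₂ → State k₁ k₂
  step σ¹ σ² h τ = τ
  step σ¹ σ² h (st s) with capture s | player s
  ... | true  | _  = τ
  ... | false | P1 = σ σ¹ h (st s)
  ... | false | P2 = σ σ² h (st s)

  history : Strategy P1 → Strategy P2 → State k₁ k₂ → ℕ →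
            Σ (List (State k₁ k₂)) (λ _ → State k₁ k₂)
  history σ¹ σ² s₀ zero = [] , s₀
  history σ¹ σ² s₀ (suc t) with history σ¹ σ² s₀ t
  ... | h , s = (h ∷ʳ s) , step σ¹ σ² h s

  play : Strategy P1 → Strategy P2 → State k₁ k₂ → ℕ → State k₁ k₂
  play σ¹ σ² s₀ t with history σ¹ σ² s₀ t
  ... | _ , s = s

  -- T(σ¹,σ² | s₀) = v : the number of t with s_t ∈ S_nc equals v
  -- (the play runs through S_nc until it first hits S_c, then stays at τ)
  data CaptureTime (σ¹ : Strategy P1) (σ² : Strategy P2) (s₀ : State k₁ k₂) : ℕ∞ → Set where
    captured : ∀ k → InSc (play σ¹ σ² s₀ k) →
               (∀ t → t < k → InSnc (play σ¹ σ² s₀ t)) →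
               CaptureTime σ¹ σ² s₀ (fin k)
    escapes  : (∀ t → InSnc (play σ¹ σ² s₀ t)) → CaptureTime σ¹ σ² s₀ ∞

  UpperValue : NState k₁ k₂ → ℕ∞ → Set
  UpperValue s v =
    IsInf (λ w → ∃[ σ¹ ] IsSup (λ w′ → ∃[ σ² ] CaptureTime σ¹ σ² (st s) w′) w) v

  LowerValue : NState k₁ k₂ → ℕ∞ → Set
  LowerValue s v =
    IsSup (λ w → ∃[ σ² ] IsInf (λ w′ → ∃[ σ¹ ] CaptureTime σ¹ σ² (st s) w′) w) v

  HasValue : NState k₁ k₂ → ℕ∞ → Set
  HasValue s v = LowerValue s v × UpperValue s v

  successors : NState k₁ k₂ → List (NState k₁ k₂)
  successors s = filter (λ s′ → next s s′ B.≟ true) (allNStates k₁ k₂)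

  update : ℕ∞ → NState k₁ k₂ → (NState k₁ k₂ → ℕ∞) → ℕ∞
  update (fin k) s T = fin k
  update ∞ s T with player s
  ... | P1 = suc∞ (minimum∞ (map T (successors s)))
  ... | P2 = suc∞ (maximum∞ (map T (successors s)))

  label : ℕ → NState k₁ k₂ → ℕ∞
  label zero s    = if capture s then fin 0 else ∞
  label (suc i) s = update (label i s) s (label i)

-- Write L i s for label G i s and best p T s for the quantity the algorithm
-- takes at a state s of player p: the minimum (p = P1) or maximum (p = P2)
-- of T over the successors of s, so that L (suc i) s = 1 + best p (L i) s
-- while L i s = ∞.  Once finite a label never changes, and a label that becomes
--      finite becomes so at exactly the step equal to its value
--      (label-settles: L i s ≡ fin k gives k ≤ i, L k s ≡ fin k and
--      L j s ≡ ∞ for j < k).  Consequently the labels satisfy the Bellman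
--      inequality 1 + best p (L i) s ≤ L (suc i) s at noncapture states.
--   2. Strategies.  The greedy pursuer moves at time t to a successor
--      minimising L (k ∸ suc t); if L k s ≡ fin k the potential L (k ∸ t)
--      stays ≤ k ∸ t along the play, so capture happens by time k.  The
--      greedy evader maximises L (i ∸ suc t); if L i s ≡ ∞ the potential
--      stays ∞ up to time i, so capture cannot happen before time i + 1.
--   3. Values.  A strategy guaranteeing a bound on every capture time bounds
--      the value of the game.  If T̂(s) = n this forces every finite label
--      of s to equal n and every infinite label L i s to satisfy i < n,
--      which is the statement of the proposition.
module Submission where

open import Defs
open import Data.Nat using (ℕ; zero; suc; _+_; _<_; _≤_; _∸_; z≤n; s≤s; _≤?_)
open import Data.Nat.Properties
  using (≤-refl; ≤-trans; ≤-antisym; ≤-pred; n≤1+n; <⇒≤; <⇒≱; ≰⇒>; ≤-<-trans;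
         m<n⇒m<1+n; m<1+n⇒m<n∨m≡n; m≤n⇒∃[o]m+o≡n; +-comm; +-identityʳ; +-suc;
         0∸n≡0; n∸n≡0; m∸n≡0⇒m≤n;
         ⊓-sel; ⊔-sel; m⊓n≤m; m⊓n≤n; m≤m⊔n; m≤n⊔m; ⊔-lub; ⊔-identityʳ)
open import Data.Product using (Σ; ∃; ∃-syntax; _×_; _,_; proj₁; proj₂)
open import Data.Sum using (_⊎_; inj₁; inj₂)
open import Data.Empty using (⊥; ⊥-elim)
open import Data.Unit using (⊤; tt)
open import Data.Bool using (true; false)
import Data.Bool as B
open import Data.List using (List; []; _∷_; map; foldr; length)
open import Data.List.Properties using (length-++)
open import Data.List.Membership.Propositional using (_∈_)
open import Data.List.Membership.Propositional.Properties
  using (∈-filter⁺; ∈-filter⁻; ∈-cartesianProduct⁺; ∈-allFin)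
open import Data.List.Relation.Unary.Any using (here; there)
open import Relation.Nullary using (¬_; yes; no)
open import Relation.Nullary.Decidable using (decidable-stable)
open import Relation.Binary.PropositionalEquality
  using (_≡_; refl; sym; trans; cong; subst; isEquivalence)
open import Relation.Binary.Bundles using (Preorder)
import Relation.Binary.Reasoning.Preorder as PreorderReasoning
open import Algebra.Definitions {A = ℕ∞} _≡_ using (Selective; RightIdentity)

≤∞-refl : ∀ {x} → x ≤∞ x
≤∞-refl {fin n} = fin≤fin ≤-refl
≤∞-refl {∞}     = ≤∞-top

≤∞-trans : ∀ {x y z} → x ≤∞ y → y ≤∞ z → x ≤∞ z
≤∞-trans (fin≤fin p) (fin≤fin q) = fin≤fin (≤-trans p q)
≤∞-trans _           ≤∞-top      = ≤∞-top

≤∞-antisym : ∀ {x y} → x ≤∞ y → y ≤∞ x → x ≡ y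
≤∞-antisym (fin≤fin p) (fin≤fin q) = cong fin (≤-antisym p q)
≤∞-antisym ≤∞-top      ≤∞-top      = refl

≤∞-preorder : Preorder _ _ _
≤∞-preorder = record
  { Carrier    = ℕ∞
  ; _≈_        = _≡_
  ; _≲_        = _≤∞_
  ; isPreorder = record
    { isEquivalence = isEquivalence
    ; reflexive     = λ { refl → ≤∞-refl }
    ; trans         = ≤∞-trans
    }
  }

module ≤∞-Reasoning = PreorderReasoning ≤∞-preorder

≤∞-reflexive : ∀ {x y} → x ≡ y → x ≤∞ y
≤∞-reflexive refl = ≤∞-refl

fin≤fin⁻¹ : ∀ {m n} → fin m ≤∞ fin n → m ≤ n
fin≤fin⁻¹ (fin≤fin p) = p

-- ≤∞ is decidable, hence stable under double negation; needed because a
-- capture time exists only in the ¬¬-sense.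
≤∞-stable : ∀ {x y} → ¬ ¬ (x ≤∞ y) → x ≤∞ y
≤∞-stable {x}     {∞}     _   = ≤∞-top
≤∞-stable {∞}     {fin n} ¬¬p = ⊥-elim (¬¬p λ ())
≤∞-stable {fin m} {fin n} ¬¬p =
  fin≤fin (decidable-stable (m ≤? n) λ m≰n → ¬¬p λ p → m≰n (fin≤fin⁻¹ p))

∞≤∞⇒≡∞ : ∀ {x} → ∞ ≤∞ x → x ≡ ∞
∞≤∞⇒≡∞ ≤∞-top = refl

≤∞0⇒≡0 : ∀ {x} → x ≤∞ fin 0 → x ≡ fin 0
≤∞0⇒≡0 (fin≤fin z≤n) = refl

suc∞-mono : ∀ {x y} → x ≤∞ y → suc∞ x ≤∞ suc∞ y
suc∞-mono (fin≤fin p) = fin≤fin (s≤s p)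
suc∞-mono ≤∞-top      = ≤∞-top

suc∞-cancel-≤ : ∀ {x j} → suc∞ x ≤∞ fin (suc j) → x ≤∞ fin j
suc∞-cancel-≤ {fin m} (fin≤fin (s≤s p)) = fin≤fin p

suc∞≡fin⁻¹ : ∀ {x k} → suc∞ x ≡ fin k → ∃[ q ] k ≡ suc q × x ≡ fin q
suc∞≡fin⁻¹ {fin q} refl = q , refl , refl

suc∞≡∞⁻¹ : ∀ {x} → suc∞ x ≡ ∞ → x ≡ ∞
suc∞≡∞⁻¹ {∞} refl = refl

⊓∞-sel : Selective _⊓∞_
⊓∞-sel (fin m) (fin n) with ⊓-sel m n
... | inj₁ e = inj₁ (cong fin e)
... | inj₂ e = inj₂ (cong fin e)
⊓∞-sel (fin m) ∞ = inj₁ refl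
⊓∞-sel ∞       y = inj₂ refl

⊓∞-identityʳ : RightIdentity ∞ _⊓∞_
⊓∞-identityʳ (fin m) = refl
⊓∞-identityʳ ∞       = refl

⊓∞-lb₁ : ∀ x y → (x ⊓∞ y) ≤∞ x
⊓∞-lb₁ (fin m) (fin n) = fin≤fin (m⊓n≤m m n)
⊓∞-lb₁ (fin m) ∞       = ≤∞-refl
⊓∞-lb₁ ∞       y       = ≤∞-top

⊓∞-lb₂ : ∀ x y → (x ⊓∞ y) ≤∞ y
⊓∞-lb₂ (fin m) (fin n) = fin≤fin (m⊓n≤n m n)
⊓∞-lb₂ (fin m) ∞       = ≤∞-top
⊓∞-lb₂ ∞       y       = ≤∞-refl

⊔∞-sel : Selective _⊔∞_
⊔∞-sel (fin m) (fin n) with ⊔-sel m n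
... | inj₁ e = inj₁ (cong fin e)
... | inj₂ e = inj₂ (cong fin e)
⊔∞-sel (fin m) ∞ = inj₂ refl
⊔∞-sel ∞       y = inj₁ refl

⊔∞-identityʳ : RightIdentity (fin 0) _⊔∞_
⊔∞-identityʳ (fin m) = cong fin (⊔-identityʳ m)
⊔∞-identityʳ ∞       = refl

⊔∞-ub₁ : ∀ x y → x ≤∞ (x ⊔∞ y)
⊔∞-ub₁ (fin m) (fin n) = fin≤fin (m≤m⊔n m n)
⊔∞-ub₁ (fin m) ∞       = ≤∞-top
⊔∞-ub₁ ∞       y       = ≤∞-top

⊔∞-ub₂ : ∀ x y → y ≤∞ (x ⊔∞ y)
⊔∞-ub₂ (fin m) (fin n) = fin≤fin (m≤n⊔m m n)
⊔∞-ub₂ (fin m) ∞       = ≤∞-top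
⊔∞-ub₂ ∞       y       = ≤∞-top

⊔∞-lub : ∀ {x y z} → x ≤∞ z → y ≤∞ z → (x ⊔∞ y) ≤∞ z
⊔∞-lub (fin≤fin p) (fin≤fin q) = fin≤fin (⊔-lub p q)
⊔∞-lub _           ≤∞-top      = ≤∞-top

module _ {A : Set} where

  min-lb : ∀ (f : A → ℕ∞) xs {y} → y ∈ xs → minimum∞ (map f xs) ≤∞ f y
  min-lb f (x ∷ xs) (here refl) = ⊓∞-lb₁ (f x) _
  min-lb f (x ∷ xs) (there y∈) = ≤∞-trans (⊓∞-lb₂ (f x) _) (min-lb f xs y∈)

  min-sublevel : ∀ (f g : A → ℕ∞) xs {c} → (∀ y → g y ≤∞ c → f y ≤∞ c) →
                 minimum∞ (map g xs) ≤∞ c → minimum∞ (map f xs) ≤∞ c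
  min-sublevel f g []       h gc = gc
  min-sublevel f g (x ∷ xs) h gc with ⊓∞-sel (g x) (minimum∞ (map g xs))
  ... | inj₁ e = ≤∞-trans (⊓∞-lb₁ (f x) _) (h x (subst (_≤∞ _) e gc))
  ... | inj₂ e = ≤∞-trans (⊓∞-lb₂ (f x) _)
                   (min-sublevel f g xs h (subst (_≤∞ _) e gc))

  max-ub : ∀ (f : A → ℕ∞) xs {y} → y ∈ xs → f y ≤∞ maximum∞ (map f xs)
  max-ub f (x ∷ xs) (here refl) = ⊔∞-ub₁ (f x) _
  max-ub f (x ∷ xs) (there y∈) = ≤∞-trans (max-ub f xs y∈) (⊔∞-ub₂ (f x) _)

  max-sublevel : ∀ (f g : A → ℕ∞) xs {c} → (∀ y → g y ≤∞ c → f y ≤∞ c) →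
                 maximum∞ (map g xs) ≤∞ c → maximum∞ (map f xs) ≤∞ c
  max-sublevel f g []       h gc = gc
  max-sublevel f g (x ∷ xs) h gc =
    ⊔∞-lub (h x (≤∞-trans (⊔∞-ub₁ (g x) _) gc))
           (max-sublevel f g xs h (≤∞-trans (⊔∞-ub₂ (g x) _) gc))

module Attained (_∙_ : ℕ∞ → ℕ∞ → ℕ∞) {ε : ℕ∞}
                (∙-sel : Selective _∙_) (∙-identityʳ : RightIdentity ε _∙_)
                {A : Set} (f : A → ℕ∞) where

  extremum : List A → ℕ∞
  extremum xs = foldr _∙_ ε (map f xs)

  attained : ∀ x xs → Σ A λ z → z ∈ x ∷ xs × f z ≡ extremum (x ∷ xs)
  attained x [] = x , here refl , sym (∙-identityʳ (f x))
  attained x (y ∷ ys) with ∙-sel (f x) (extremum (y ∷ ys))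
  ... | inj₁ e = x , here refl , sym e
  ... | inj₂ e with attained y ys
  ...   | z , z∈ , fz = z , there z∈ , trans fz (sym e)

  pick : A → List A → A
  pick d []       = d
  pick d (x ∷ xs) = proj₁ (attained x xs)

  pick-spec : ∀ d xs {y} → y ∈ xs → pick d xs ∈ xs × f (pick d xs) ≡ extremum xs
  pick-spec d (x ∷ xs) _ = proj₂ (attained x xs)

∸-split : ∀ k t → k ∸ t ≡ 0 ⊎ k ∸ t ≡ suc (k ∸ suc t)
∸-split zero    t       = inj₁ (0∸n≡0 t)
∸-split (suc k) zero    = inj₂ refl
∸-split (suc k) (suc t) = ∸-split k t

module _ {k₁ k₂ : ℕ} (G : GCR k₁ k₂) where
  open GCR G
  open Strategy

  private
    NS = NState k₁ k₂
    L : ℕ → NS → ℕ∞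
    L = label G

  successors-complete : ∀ {s s′} → next s s′ ≡ true → s′ ∈ successors G s
  successors-complete {s} {a , b , p} e =
    ∈-filter⁺ (λ s′ → next s s′ B.≟ true)
      (∈-cartesianProduct⁺ (∈-allFin a)
        (∈-cartesianProduct⁺ (∈-allFin b) (player∈ p))) e
    where
    player∈ : ∀ p → p ∈ P1 ∷ P2 ∷ []
    player∈ P1 = here refl
    player∈ P2 = there (here refl)

  successors-sound : ∀ {s s′} → s′ ∈ successors G s → next s s′ ≡ true
  successors-sound {s} s′∈ =
    proj₂ (∈-filter⁻ (λ s′ → next s s′ B.≟ true) {xs = allNStates k₁ k₂} s′∈)

  successor-exists : ∀ s → capture s ≡ false → ∃[ s′ ] s′ ∈ successors G s
  successor-exists s nc with next-nonempty s nc
  ... | s′ , e = s′ , successors-complete e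

  best : Player → (NS → ℕ∞) → NS → ℕ∞
  best P1 T s = minimum∞ (map T (successors G s))
  best P2 T s = maximum∞ (map T (successors G s))

  best-sublevel : ∀ p (T U : NS → ℕ∞) s {c} → (∀ y → U y ≤∞ c → T y ≤∞ c) →
                  best p U s ≤∞ c → best p T s ≤∞ c
  best-sublevel P1 T U s = min-sublevel T U (successors G s)
  best-sublevel P2 T U s = max-sublevel T U (successors G s)

  best-mono : ∀ p {T U : NS → ℕ∞} s → (∀ y → T y ≤∞ U y) → best p T s ≤∞ best p U s
  best-mono p {T} {U} s T≤U =
    best-sublevel p T U s (λ y Uy≤c → ≤∞-trans (T≤U y) Uy≤c) ≤∞-refl

  choice : Player → (NS → ℕ∞) → NS → NS
  choice P1 T s = Attained.pick _⊓∞_ ⊓∞-sel ⊓∞-identityʳ T s (successors G s)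
  choice P2 T s = Attained.pick _⊔∞_ ⊔∞-sel ⊔∞-identityʳ T s (successors G s)

  choice-spec : ∀ p T s → capture s ≡ false →
                next s (choice p T s) ≡ true × T (choice p T s) ≡ best p T s
  choice-spec p T s nc = successors-sound (proj₁ (spec p)) , proj₂ (spec p)
    where
    spec : ∀ p → choice p T s ∈ successors G s × T (choice p T s) ≡ best p T s
    spec P1 = Attained.pick-spec _⊓∞_ ⊓∞-sel ⊓∞-identityʳ T s (successors G s)
                (proj₂ (successor-exists s nc))
    spec P2 = Attained.pick-spec _⊔∞_ ⊔∞-sel ⊔∞-identityʳ T s (successors G s)
                (proj₂ (successor-exists s nc))

  label-cases : ∀ i s → (∃[ k ] L i s ≡ fin k) ⊎ L i s ≡ ∞
  label-cases i s with L i s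
  ... | fin k = inj₁ (k , refl)
  ... | ∞     = inj₂ refl

  label-fin-step : ∀ {i s k} → L i s ≡ fin k → L (suc i) s ≡ fin k
  label-fin-step {i} {s} e = cong (λ x → update G x s (L i)) e

  label-∞-step : ∀ {i s} → L i s ≡ ∞ → L (suc i) s ≡ suc∞ (best (player s) (L i) s)
  label-∞-step {i} {s@(_ , _ , P1)} e = cong (λ x → update G x s (L i)) e
  label-∞-step {i} {s@(_ , _ , P2)} e = cong (λ x → update G x s (L i)) e

  label-persists : ∀ {i j s k} → L i s ≡ fin k → i ≤ j → L j s ≡ fin k
  label-persists {i} {j} {s} e i≤j with m≤n⇒∃[o]m+o≡n i≤j
  ... | o , refl = go o
    where
    go : ∀ o → L (i + o) s ≡ _
    go zero    rewrite +-identityʳ i = e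
    go (suc o) rewrite +-suc i o     = label-fin-step {i + o} (go o)

  label-antitone : ∀ {i j} s → i ≤ j → L j s ≤∞ L i s
  label-antitone {i} {j} s i≤j with L i s in e
  ... | fin k = subst (_≤∞ fin k) (sym (label-persists e i≤j)) ≤∞-refl
  ... | ∞     = ≤∞-top

  label-∞-below : ∀ {i j s} → L j s ≡ ∞ → i ≤ j → L i s ≡ ∞
  label-∞-below {s = s} e i≤j = ∞≤∞⇒≡∞ (subst (_≤∞ _) e (label-antitone s i≤j))

  capture-label : ∀ {s} i → capture s ≡ true → L i s ≡ fin 0
  capture-label zero    c rewrite c = refl
  capture-label (suc i) c = label-fin-step {i} (capture-label i c)

  label-∞-uncaptured : ∀ {i s} → L i s ≡ ∞ → capture s ≡ true → ⊥
  label-∞-uncaptured {i} e c with () ← trans (sym (capture-label i c)) e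

  label-∞-noncapture : ∀ {i s} → L i s ≡ ∞ → capture s ≡ false
  label-∞-noncapture {i} {s} e with capture s in c
  ... | false = refl
  ... | true  = ⊥-elim (label-∞-uncaptured {i} e c)

  Settled : NS → ℕ → Set
  Settled s k = L k s ≡ fin k × (∀ j → j < k → L j s ≡ ∞)

  -- Inductive step of label-settles: a label that becomes finite at step
  -- i + 1 takes the value 1 + q where q ≤ i is attained by a successor,
  -- and it would already have been assigned 1 + q at step q + 1.
  settle-step : ∀ {i s q} → (∀ y {r} → L i y ≡ fin r → r ≤ i × Settled y r) →
                L i s ≡ ∞ → best (player s) (L i) s ≡ fin q →
                suc q ≤ suc i × Settled s (suc q)
  settle-step {i} {s} {q} settled e∞ bq = s≤s q≤i , L₁₊q , unreached
    where
    p = player s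
    q≤i : q ≤ i
    q≤i = proj₁ (settled _ (trans (proj₂ (choice-spec p (L i) s nc)) bq))
      where nc = label-∞-noncapture {i} e∞
    sublevel : ∀ y → L i y ≤∞ fin q → L q y ≤∞ fin q
    sublevel y Liy≤q with L i y in e
    ... | fin r = let r≤q = fin≤fin⁻¹ Liy≤q in
      subst (_≤∞ fin q) (sym (label-persists (proj₁ (proj₂ (settled y e))) r≤q))
            (fin≤fin r≤q)
    best≤q : best p (L q) s ≤∞ fin q
    best≤q = best-sublevel p (L q) (L i) s sublevel (≤∞-reflexive bq)
    q≤best : fin q ≤∞ best p (L q) s
    q≤best = subst (_≤∞ _) bq (best-mono p s (λ y → label-antitone y q≤i))
    Lq∞ : L q s ≡ ∞
    Lq∞ = label-∞-below e∞ q≤i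
    L₁₊q : L (suc q) s ≡ fin (suc q)
    L₁₊q = trans (label-∞-step {q} Lq∞) (cong suc∞ (≤∞-antisym best≤q q≤best))
    unreached : ∀ j → j < suc q → L j s ≡ ∞
    unreached j j<1+q = label-∞-below e∞ (≤-trans (≤-pred j<1+q) q≤i)

  label-settles : ∀ i s {k} → L i s ≡ fin k → k ≤ i × Settled s k
  label-settles zero s e with capture s in c
  ... | true  with refl ← e = z≤n , capture-label 0 c , λ j ()
  ... | false with () ← e
  label-settles (suc i) s e with label-cases i s
  ... | inj₁ (k′ , eᵢ) with refl ← trans (sym (label-fin-step {i} eᵢ)) e =
    let k≤i , settled = label-settles i s eᵢ in ≤-trans k≤i (n≤1+n i) , settled
  ... | inj₂ eᵢ with suc∞≡fin⁻¹ (trans (sym (label-∞-step {i} eᵢ)) e)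
  ...   | q , refl , bq = settle-step (label-settles i) eᵢ bq

  label-zero-capture : ∀ {i s} → L i s ≡ fin 0 → capture s ≡ true
  label-zero-capture {i} {s} e with capture s | proj₁ (proj₂ (label-settles i s e))
  ... | true  | _  = refl

  label-zero-noncapture : ∀ {i s} → L i s ≡ fin 0 → capture s ≡ false → ⊥
  label-zero-noncapture {i} e nc with () ← trans (sym (label-zero-capture {i} e)) nc

  bellman : ∀ i s → capture s ≡ false → suc∞ (best (player s) (L i) s) ≤∞ L (suc i) s
  bellman i s nc with label-cases i s
  ... | inj₂ eᵢ = ≤∞-reflexive (sym (label-∞-step {i} eᵢ))
  ... | inj₁ (zero , eᵢ) = ⊥-elim (label-zero-noncapture {i} eᵢ nc)
  ... | inj₁ (suc q , eᵢ) with label-settles i s eᵢ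
  ...   | 1+q≤i , L₁₊q , unreached = begin
    suc∞ (best p (L i) s)     ≲⟨ suc∞-mono (best-mono p s λ y → label-antitone y q≤i) ⟩
    suc∞ (best p (L q) s)     ≡⟨ sym (label-∞-step {q} (unreached q ≤-refl)) ⟩
    L (suc q) s               ≡⟨ L₁₊q ⟩
    fin (suc q)               ≡⟨ sym (label-fin-step {i} eᵢ) ⟩
    L (suc i) s               ∎
    where
    open ≤∞-Reasoning
    p = player s
    q≤i = ≤-trans (n≤1+n q) 1+q≤i

  -- A label that is still ∞ at step j + 1 forces the mover's best previous
  -- label to be ∞: whatever the mover does, the next state is unlabelled.
  -- This is what the evader exploits.
  best-∞ : ∀ {j s} → L (suc j) s ≡ ∞ → best (player s) (L j) s ≡ ∞
  best-∞ {j} e = suc∞≡∞⁻¹ (trans (sym (label-∞-step {j} Lⱼ∞)) e)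
    where Lⱼ∞ = label-∞-below e (n≤1+n j)

  greedy : (p : Player) → (ℕ → NS → ℕ∞) → Strategy G p
  greedy p T = record { σ = move ; legal = legal-move }
    where
    move : List (State k₁ k₂) → State k₁ k₂ → State k₁ k₂
    move h τ      = τ
    move h (st s) = st (choice p (T (length h)) s)
    legal-move : ∀ h s → player s ≡ p → capture s ≡ false → Move G s (move h (st s))
    legal-move h s _ nc = proj₁ (choice-spec p (T (length h)) s nc)

  pursuer : ℕ → Strategy G P1
  pursuer k = greedy P1 (λ t → L (k ∸ suc t))

  evader : ℕ → Strategy G P2
  evader i = greedy P2 (λ t → L (i ∸ suc t))

  module Plays (σ¹ : Strategy G P1) (σ² : Strategy G P2) (s₀ : NS) where

    position : ℕ → State k₁ k₂
    position = play G σ¹ σ² (st s₀)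

    past : ℕ → List (State k₁ k₂)
    past t = proj₁ (history G σ¹ σ² (st s₀) t)

    -- The greedy strategies read the time off the length of the history.
    past-length : ∀ t → length (past t) ≡ t
    past-length zero    = refl
    past-length (suc t) =
      trans (length-++ (past t)) (trans (+-comm _ 1) (cong suc (past-length t)))

    strategy-of : Player → List (State k₁ k₂) → State k₁ k₂ → State k₁ k₂
    strategy-of P1 = σ σ¹
    strategy-of P2 = σ σ²

    play-step : ∀ {t s} → position t ≡ st s → capture s ≡ false →
                position (suc t) ≡ strategy-of (player s) (past t) (st s)
    play-step {t} {s} ps nc =
      trans (cong (step G σ¹ σ² (past t)) ps) (step-noncapture s nc)
      where
      step-noncapture : ∀ s → capture s ≡ false →
        step G σ¹ σ² (past t) (st s) ≡ strategy-of (player s) (past t) (st s)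
      step-noncapture s@(_ , _ , P1) nc rewrite nc = refl
      step-noncapture s@(_ , _ , P2) nc rewrite nc = refl

    play-move : ∀ {t s} → position t ≡ st s → capture s ≡ false →
                ∃[ s′ ] position (suc t) ≡ st s′ × next s s′ ≡ true
    play-move {t} {s} ps nc with move-target (legal-of s nc)
      where
      legal-of : ∀ s → capture s ≡ false →
                 Move G s (strategy-of (player s) (past t) (st s))
      legal-of s@(_ , _ , P1) = legal σ¹ (past t) s refl
      legal-of s@(_ , _ , P2) = legal σ² (past t) s refl
      move-target : ∀ {x} → Move G s x → ∃[ s′ ] x ≡ st s′ × next s s′ ≡ true
      move-target {st s′} m = s′ , refl , m
    ... | s′ , e , m = s′ , trans (play-step {t} ps nc) e , m

    invariant : (P : ℕ → NS → Set) → P 0 s₀ →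
                (∀ {t s} → position t ≡ st s → capture s ≡ false → P t s →
                  ∃[ s′ ] position (suc t) ≡ st s′ × P (suc t) s′) →
                ∀ t → (∀ u → u < t → InSnc G (position u)) →
                ∃[ s ] position t ≡ st s × P t s
    invariant P P₀ preserved zero    _      = s₀ , refl , P₀
    invariant P P₀ preserved (suc t) before
      with invariant P P₀ preserved t (λ u u<t → before u (m<n⇒m<1+n u<t))
    ... | s , ps , Ps = preserved {t} ps (subst (InSnc G) ps (before t ≤-refl)) Ps

    capture-time-exists : ¬ ¬ ∃ (CaptureTime G σ¹ σ² (st s₀))
    capture-time-exists no-time = no-time (∞ , escapes λ t → uncaptured (suc t) t ≤-refl)
      where
      uncaptured : ∀ t u → u < t → InSnc G (position u)
      uncaptured (suc t) u u<1+t with m<1+n⇒m<n∨m≡n u<1+t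
      ... | inj₁ u<t = uncaptured t u u<t
      ... | inj₂ refl
        with invariant (λ _ _ → ⊤) tt
               (λ {u} ps nc _ → let s′ , ps′ , _ = play-move {u} ps nc in s′ , ps′ , tt)
               t (uncaptured t)
      ...   | s , ps , _ with capture s in c
      ...     | true  =
        ⊥-elim (no-time (fin t , captured t (subst (InSc G) (sym ps) c) (uncaptured t)))
      ...     | false = subst (InSnc G) (sym ps) c

  pursuit-bounds-value : ∀ {s v u} → LowerValue G s v → (σ¹ : Strategy G P1) →
    (∀ σ² w → CaptureTime G σ¹ σ² (st s) w → w ≤∞ u) → v ≤∞ u
  pursuit-bounds-value {s} (_ , least) σ¹ guarantee = least _ λ where
    w (σ² , below , _) → ≤∞-stable λ w≰u →
      Plays.capture-time-exists σ¹ σ² s λ (w′ , ct) →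
        w≰u (≤∞-trans (below w′ (σ¹ , ct)) (guarantee σ² w′ ct))

  evasion-bounds-value : ∀ {s v u} → UpperValue G s v → (σ² : Strategy G P2) →
    (∀ σ¹ w → CaptureTime G σ¹ σ² (st s) w → u ≤∞ w) → u ≤∞ v
  evasion-bounds-value {s} (_ , greatest) σ² guarantee = greatest _ λ where
    w (σ¹ , above , _) → ≤∞-stable λ u≰w →
      Plays.capture-time-exists σ¹ σ² s λ (w′ , ct) →
        u≰w (≤∞-trans (guarantee σ¹ w′ ct) (above w′ (σ² , ct)))

  -- Against any evader, the pursuer of horizon k captures a play started at
  -- a state with L k s₀ ≡ fin k within k moves: the potential L (k ∸ t) at
  -- the current state stays ≤ k ∸ t, and potential 0 means capture.
  module Pursuit (k : ℕ) (σ² : Strategy G P2) (s₀ : NS)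
                 (settled : L k s₀ ≡ fin k) where
    open Plays (pursuer k) σ² s₀

    pursuer-move : ∀ {t s} → position t ≡ st s → capture s ≡ false →
      ∃[ s′ ] position (suc t) ≡ st s′ ×
              L (k ∸ suc t) s′ ≤∞ best (player s) (L (k ∸ suc t)) s
    pursuer-move {t} {s@(_ , _ , P1)} ps nc =
      choice P1 T s , chosen , ≤∞-reflexive (proj₂ (choice-spec P1 T s nc))
      where
      T = L (k ∸ suc t)
      chosen : position (suc t) ≡ st (choice P1 T s)
      chosen = trans (play-step {t} ps nc)
                     (cong (λ n → st (choice P1 (L (k ∸ suc n)) s)) (past-length t))
    pursuer-move {t} {s@(_ , _ , P2)} ps nc with play-move {t} ps nc
    ... | s′ , ps′ , m =
      s′ , ps′ , max-ub (L (k ∸ suc t)) (successors G s) (successors-complete m)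

    -- The invariant: by the Bellman inequality the pursuer's move lowers
    -- the potential by one.
    Potential : ℕ → NS → Set
    Potential t s = L (k ∸ t) s ≤∞ fin (k ∸ t)

    potential-preserved : ∀ {t s} → position t ≡ st s → capture s ≡ false →
                          Potential t s →
                          ∃[ s′ ] position (suc t) ≡ st s′ × Potential (suc t) s′
    potential-preserved {t} {s} ps nc pot with ∸-split k t
    ... | inj₁ k∸t≡0 = ⊥-elim (label-zero-noncapture {0} L₀≡0 nc)
      where L₀≡0 = ≤∞0⇒≡0 (subst (λ n → L n s ≤∞ fin n) k∸t≡0 pot)
    ... | inj₂ k∸t≡1+j with pursuer-move {t} ps nc
    ...   | s′ , ps′ , s′≤best = s′ , ps′ , ≤∞-trans s′≤best best≤j
      where
      j = k ∸ suc t
      best≤j : best (player s) (L j) s ≤∞ fin j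
      best≤j = suc∞-cancel-≤ (≤∞-trans (bellman j s nc)
                                        (subst (λ n → L n s ≤∞ fin n) k∸t≡1+j pot))

    -- At time k the potential is 0, i.e. the state is a capture state.
    no-survival : (∀ u → u ≤ k → InSnc G (position u)) → ⊥
    no-survival uncaptured
      with invariant Potential (≤∞-reflexive settled) potential-preserved k
                     (λ u u<k → uncaptured u (<⇒≤ u<k))
    ... | s , ps , pot = label-zero-noncapture {0} L₀≡0 nc
      where
      L₀≡0 = ≤∞0⇒≡0 (subst (λ n → L n s ≤∞ fin n) (n∸n≡0 k) pot)
      nc = subst (InSnc G) ps (uncaptured k ≤-refl)

    captured-by : ∀ w → CaptureTime G (pursuer k) σ² (st s₀) w → w ≤∞ fin k
    captured-by .∞ (escapes uncaptured) = ⊥-elim (no-survival λ u _ → uncaptured u)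
    captured-by .(fin k′) (captured k′ _ before) with k′ ≤? k
    ... | yes k′≤k = fin≤fin k′≤k
    ... | no  k′≰k =
      ⊥-elim (no-survival λ u u≤k → before u (≤-<-trans u≤k (≰⇒> k′≰k)))

  -- Against any pursuer, the evader of horizon i survives i + 1 moves from a
  -- state with L i s₀ ≡ ∞: the label L (i ∸ t) at the current state stays ∞
  -- for t ≤ i, and an infinite label means no capture.
  module Evasion (i : ℕ) (σ¹ : Strategy G P1) (s₀ : NS)
                 (unfinished : L i s₀ ≡ ∞) where
    open Plays σ¹ (evader i) s₀

    evader-move : ∀ {t s} → position t ≡ st s → capture s ≡ false →
      ∃[ s′ ] position (suc t) ≡ st s′ ×
              best (player s) (L (i ∸ suc t)) s ≤∞ L (i ∸ suc t) s′
    evader-move {t} {s@(_ , _ , P1)} ps nc with play-move {t} ps nc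
    ... | s′ , ps′ , m =
      s′ , ps′ , min-lb (L (i ∸ suc t)) (successors G s) (successors-complete m)
    evader-move {t} {s@(_ , _ , P2)} ps nc =
      choice P2 T s , chosen , ≤∞-reflexive (sym (proj₂ (choice-spec P2 T s nc)))
      where
      T = L (i ∸ suc t)
      chosen : position (suc t) ≡ st (choice P2 T s)
      chosen = trans (play-step {t} ps nc)
                     (cong (λ n → st (choice P2 (L (i ∸ suc n)) s)) (past-length t))

    -- The invariant, kept by best-∞ while t < i.
    Unfinished : ℕ → NS → Set
    Unfinished t s = t ≤ i → L (i ∸ t) s ≡ ∞

    unfinished-preserved : ∀ {t s} → position t ≡ st s → capture s ≡ false →
                           Unfinished t s →
                           ∃[ s′ ] position (suc t) ≡ st s′ × Unfinished (suc t) s′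
    unfinished-preserved {t} {s} ps nc unf with evader-move {t} ps nc
    ... | s′ , ps′ , best≤s′ = s′ , ps′ , still-unfinished
      where
      still-unfinished : Unfinished (suc t) s′
      still-unfinished t<i with ∸-split i t
      ... | inj₁ i∸t≡0 = ⊥-elim (<⇒≱ t<i (m∸n≡0⇒m≤n i∸t≡0))
      ... | inj₂ i∸t≡1+j = ∞≤∞⇒≡∞ (subst (_≤∞ _) (best-∞ {i ∸ suc t} L₁₊ⱼ∞) best≤s′)
        where
        L₁₊ⱼ∞ = subst (λ n → L n s ≡ ∞) i∸t≡1+j (unf (<⇒≤ t<i))

    -- A capture at time k′ ≤ i would be at a state with label ∞.
    survives : ∀ w → CaptureTime G σ¹ (evader i) (st s₀) w → fin (suc i) ≤∞ w
    survives .∞ (escapes _) = ≤∞-top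
    survives .(fin k′) (captured k′ at-k′ before) with suc i ≤? k′
    ... | yes i<k′ = fin≤fin i<k′
    ... | no  i≮k′
      with invariant Unfinished (λ _ → unfinished) unfinished-preserved k′ before
    ...   | s , ps , unf =
      ⊥-elim (label-∞-uncaptured {i ∸ k′} (unf (≤-pred (≰⇒> i≮k′)))
                                          (subst (InSc G) ps at-k′))

  -- Comparing labels with the value: a finite label k of s bounds the value
  -- n from above (the pursuer of horizon k captures within k moves) and from
  -- below (the label was ∞ at step k - 1, where the evader survives k moves);
  -- an infinite label L i s forces i < n.
  unfinished-label<value : ∀ {s n} i → UpperValue G s (fin n) → L i s ≡ ∞ → i < n
  unfinished-label<value {s} i upper e =
    fin≤fin⁻¹ (evasion-bounds-value upper (evader i) λ σ¹ →
                 Evasion.survives i σ¹ s e)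

  value≤finite-label : ∀ {s n k} m → LowerValue G s (fin n) → L m s ≡ fin k → n ≤ k
  value≤finite-label {s} {k = k} m lower e =
    fin≤fin⁻¹ (pursuit-bounds-value lower (pursuer k) λ σ² →
                 Pursuit.captured-by k σ² s L-k)
    where L-k = proj₁ (proj₂ (label-settles m s e))

  finite-label≤value : ∀ {s n k} m → UpperValue G s (fin n) → L m s ≡ fin k → k ≤ n
  finite-label≤value {k = zero}  m _     _ = z≤n
  finite-label≤value {s} {k = suc p} m upper e =
    unfinished-label<value p upper (proj₂ (proj₂ (label-settles m s e)) p ≤-refl)

-- Only
-- the value at s itself is used, not the existence of values elsewhere.
proposition3p18 : ∀ {k₁ k₂} (G : GCR k₁ k₂) →
    (∀ s → ∃[ v ] HasValue G s v) →
    ∀ (n : ℕ) (s : NState k₁ k₂) → HasValue G s (fin n) →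
    (∀ m → m < n → label G m s ≡ ∞) × (∀ m → n ≤ m → label G m s ≡ fin n)
proposition3p18 G _ n s (lower , upper) = unlabelled-before , labelled-from
  where
  finite-label≡value : ∀ m {k} → label G m s ≡ fin k → k ≡ n
  finite-label≡value m e =
    ≤-antisym (finite-label≤value G m upper e) (value≤finite-label G m lower e)

  unlabelled-before : ∀ m → m < n → label G m s ≡ ∞
  unlabelled-before m m<n with label-cases G m s
  ... | inj₂ e       = e
  ... | inj₁ (k , e) =
    ⊥-elim (<⇒≱ m<n (subst (_≤ m) (finite-label≡value m e) k≤m))
    where k≤m = proj₁ (label-settles G m s e)

  labelled-from : ∀ m → n ≤ m → label G m s ≡ fin n
  labelled-from m n≤m with label-cases G m s
  ... | inj₁ (k , e) = trans e (cong fin (finite-label≡value m e))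
  ... | inj₂ e       = ⊥-elim (<⇒≱ (unfinished-label<value G m upper e) n≤m)
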